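{- Let $\mathcal{E}$ be a set of equations and $\mathcal{R}$ a set of rewrite rules over the terms described in the context, with $\sim$, $\to_\beta$, $\to$, $\rhd\!\!\!\!\rhd$ as defined there, and assume $\mathcal{E}$ is linear. Then: (i) for all terms $t,u$, if $t\to^* u$ then there exists $v$ with $t\rhd\!\!\!\!\rhd^* v$ and $v\sim u$; (ii) for all terms $t,u$: there exists $w$ with $t\to^* w$ and $u\to^* w$ if and only if there exist $a,b$ with $t\rhd\!\!\!\!\rhd^* a$, $a\sim b$ and $u\rhd\!\!\!\!\rhd^* b$.
   Context: Terms (considered modulo renaming of bound variables): $t,u ::= s \mid x \mid f \mid [x:t]u \mid tu \mid (x:t)u$, where $s\in\{\star,\Box\}$ is a sort, $x$ ranges over an infinite set of variables, $f$ ranges over a set $\mathcal{F}$ of symbols, $[x:t]u$ is an abstraction (binding $x$ in $u$), $tu$ an application and $(x:t)u$ a dependent product (binding $x$ in $u$). Every symbol $f$ has an arity $\alpha_f\in\mathbb{N}$. A term is algebraic if it is built only from variables and applications $f t_1\ldots t_n$ with $n=\alpha_f$. $\mathrm{FV}(t)$ is the set of free variables of $t$; $t|_p$ is the subterm at position $p$ and $t[u]_p$ the replacement of $t|_p$ by $u$. A rewrite rule is a pair $l\to r$ of terms with $l$ algebraic, $l$ not a variable, and $\mathrm{FV}(r)\subseteq\mathrm{FV}(l)$. For a set of rules $\mathcal{R}$, $t\to_{\mathcal{R}} t'$ iff there are a position $p$, a rule $l\to r\in\mathcal{R}$ and a substitution $\sigma$ with $t|_p=l\sigma$ and $t'=t[r\sigma]_p$.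 $t\to_\beta t'$ iff there is a position $p$ with $t|_p=([x:U]v)\,u$ and $t'=t[v\{x\mapsto u\}]_p$. A set of equations $\mathcal{E}$ is a set of rewrite rules that is symmetric ($l\to r\in\mathcal{E}$ iff $r\to l\in\mathcal{E}$), such that for each $l\to r\in\mathcal{E}$ both $l$ and $r$ are algebraic, headed by a symbol, and $\mathrm{FV}(l)=\mathrm{FV}(r)$. $\mathcal{E}$ is linear if in every rule of $\mathcal{E}$ no variable occurs more than once in the left-hand side and no variable occurs more than once in the right-hand side. $\sim$ is the reflexive and transitive closure of $\to_{\mathcal{E}}$. $\to$ denotes $\to_\beta\cup\to_{\mathcal{R}}\cup\to_{\mathcal{E}}$. $t\rhd\!\!\!\!\rhd u$ iff $t\to_\beta u$, or there exists $t'$ with $t\sim t'$ and $t'\to_{\mathcal{R}} u$. For a relation $S$, $S^*$ is its reflexive and transitive closure. -}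

module Defs where

open import Data.Nat using (ℕ; zero; suc; _+_; _≤_)
open import Data.Fin using (Fin; zero; suc; _≟_)
open import Data.Vec using (Vec; []; _∷_)
open import Data.Vec.Relation.Unary.All using (All)
open import Data.Product using (Σ; Σ-syntax; _×_; ∃; ∃-syntax)
open import Relation.Nullary using (¬_; yes; no)
open import Relation.Binary.PropositionalEquality using (_≡_)
open import Relation.Binary.Construct.Closure.ReflexiveTransitive using (Star)

data Sort : Set where
  star box : Sort

-- Terms over a set F of symbols with arity α, modulo α-conversion:
-- well-scoped de Bruijn terms with n free variables.
module Terms (F : Set) (α : F → ℕ) where

  data Term (n : ℕ) : Set where
    sort : Sort → Term n
    var  : Fin n → Term n
    fun  : F → Term n
    lam  : Term n → Term (suc n) → Term n
    app  : Term n → Term n → Term n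
    pi   : Term n → Term (suc n) → Term n

  ext : ∀ {m n} → (Fin m → Fin n) → Fin (suc m) → Fin (suc n)
  ext ρ zero    = zero
  ext ρ (suc i) = suc (ρ i)

  ren : ∀ {m n} → (Fin m → Fin n) → Term m → Term n
  ren ρ (sort s)  = sort s
  ren ρ (var x)   = var (ρ x)
  ren ρ (fun f)   = fun f
  ren ρ (lam A b) = lam (ren ρ A) (ren (ext ρ) b)
  ren ρ (app t u) = app (ren ρ t) (ren ρ u)
  ren ρ (pi A b)  = pi (ren ρ A) (ren (ext ρ) b)

  exts : ∀ {m n} → (Fin m → Term n) → Fin (suc m) → Term (suc n)
  exts σ zero    = var zero
  exts σ (suc i) = ren suc (σ i)

  sub : ∀ {m n} → (Fin m → Term n) → Term m → Term n
  sub σ (sort s)  = sort s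
  sub σ (var x)   = σ x
  sub σ (fun f)   = fun f
  sub σ (lam A b) = lam (sub σ A) (sub (exts σ) b)
  sub σ (app t u) = app (sub σ t) (sub σ u)
  sub σ (pi A b)  = pi (sub σ A) (sub (exts σ) b)

  single : ∀ {n} → Term n → Fin (suc n) → Term n
  single u zero    = u
  single u (suc i) = var i

  _[_] : ∀ {n} → Term (suc n) → Term n → Term n
  v [ u ] = sub (single u) v

  apps : ∀ {n k} → Term n → Vec (Term n) k → Term n
  apps h []       = h
  apps h (t ∷ ts) = apps (app h t) ts

  data Alg {n : ℕ} : Term n → Set where
    var : (x : Fin n) → Alg (var x)
    fn  : (f : F) (ts : Vec (Term n) (α f)) → All Alg ts → Alg (apps (fun f) ts)

  SymHeaded : ∀ {n} → Term n → Set
  SymHeaded {n} t = Σ[ f ∈ F ] Σ[ ts ∈ Vec (Term n) (α f) ] t ≡ apps (fun f) ts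

  IsVar : ∀ {n} → Term n → Set
  IsVar {n} t = Σ[ x ∈ Fin n ] t ≡ var x

  data _∈FV_ {n : ℕ} (x : Fin n) : Term n → Set where
    var  : x ∈FV var x
    lamL : ∀ {A b} → x ∈FV A → x ∈FV lam A b
    lamR : ∀ {A b} → suc x ∈FV b → x ∈FV lam A b
    appL : ∀ {t u} → x ∈FV t → x ∈FV app t u
    appR : ∀ {t u} → x ∈FV u → x ∈FV app t u
    piL  : ∀ {A b} → x ∈FV A → x ∈FV pi A b
    piR  : ∀ {A b} → suc x ∈FV b → x ∈FV pi A b

  occ : ∀ {n} → Fin n → Term n → ℕ
  occ x (sort s) = 0
  occ x (var y) with x ≟ y
  ... | yes _ = 1
  ... | no  _ = 0
  occ x (fun f) = 0
  occ x (lam A b) = occ x A + occ (suc x) b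
  occ x (app t u) = occ x t + occ x u
  occ x (pi A b)  = occ x A + occ (suc x) b

  -- a set of rules: rules l → r whose variables range over Fin m
  RuleSet : Set₁
  RuleSet = (m : ℕ) → Term m → Term m → Set

  IsRewriteRules : RuleSet → Set
  IsRewriteRules R = ∀ m (l r : Term m) → R m l r →
    Alg l × ¬ IsVar l × (∀ x → x ∈FV r → x ∈FV l)

  IsEquations : RuleSet → Set
  IsEquations E =
    IsRewriteRules E ×
    (∀ m (l r : Term m) → E m l r → E m r l) ×
    (∀ m (l r : Term m) → E m l r →
       Alg l × Alg r × SymHeaded l × SymHeaded r ×
       (∀ x → (x ∈FV l → x ∈FV r) × (x ∈FV r → x ∈FV l)))

  Linear : RuleSet → Set
  Linear E = ∀ m (l r : Term m) → E m l r →
    (∀ x → occ x l ≤ 1) × (∀ x → occ x r ≤ 1)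

  data Ctx (H : ∀ {n} → Term n → Term n → Set) : ∀ {n} → Term n → Term n → Set where
    top  : ∀ {n} {t u : Term n} → H t u → Ctx H t u
    lamL : ∀ {n} {A A' : Term n} {b} → Ctx H A A' → Ctx H (lam A b) (lam A' b)
    lamR : ∀ {n} {A : Term n} {b b'} → Ctx H b b' → Ctx H (lam A b) (lam A b')
    appL : ∀ {n} {t t' u : Term n} → Ctx H t t' → Ctx H (app t u) (app t' u)
    appR : ∀ {n} {t u u' : Term n} → Ctx H u u' → Ctx H (app t u) (app t u')
    piL  : ∀ {n} {A A' : Term n} {b} → Ctx H A A' → Ctx H (pi A b) (pi A' b)
    piR  : ∀ {n} {A : Term n} {b b'} → Ctx H b b' → Ctx H (pi A b) (pi A b')

  data HeadRule (R : RuleSet) {n : ℕ} : Term n → Term n → Set where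
    rule : ∀ {m l r} → R m l r → (σ : Fin m → Term n) → HeadRule R (sub σ l) (sub σ r)

  data HeadBeta {n : ℕ} : Term n → Term n → Set where
    beta : ∀ (U : Term n) v u → HeadBeta (app (lam U v) u) (v [ u ])

  _⟶[_]_ : ∀ {n} → Term n → RuleSet → Term n → Set
  t ⟶[ R ] u = Ctx (HeadRule R) t u

  _⟶β_ : ∀ {n} → Term n → Term n → Set
  t ⟶β u = Ctx HeadBeta t u

  module System (R E : RuleSet) where

    _∼_ : ∀ {n} → Term n → Term n → Set
    _∼_ = Star (λ t u → t ⟶[ E ] u)

    data _⟶_ {n : ℕ} (t u : Term n) : Set where
      β : t ⟶β u → t ⟶ u
      ρ : t ⟶[ R ] u → t ⟶ u
      ε : t ⟶[ E ] u → t ⟶ u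

    _⟶*_ : ∀ {n} → Term n → Term n → Set
    _⟶*_ = Star _⟶_

    data _▷▷_ {n : ℕ} (t u : Term n) : Set where
      β   : t ⟶β u → t ▷▷ u
      mod : ∀ {t'} → t ∼ t' → t' ⟶[ R ] u → t ▷▷ u

    _▷▷*_ : ∀ {n} → Term n → Term n → Set
    _▷▷*_ = Star _▷▷_

{-# OPTIONS --safe #-}
module Submission where

-- Both sides of a linear equation are first-order terms headed by a symbol, so an
-- E-step neither creates nor destroys a β-redex: a β-step following an E-step is
-- either at a position disjoint from it, or inside the instance of a variable of the
-- equation, which occurs at most once on each side.  In both cases the β-step can be
-- done first, so ∼ followed by →β becomes at most one →β followed by ∼.  Pushing all
-- E-steps of a →-reduction to its end this way turns it into a ▷▷-reduction followed
-- by ∼, since an R-step preceded by ∼ is a ▷▷-step.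

open import Defs
open import Data.Nat using (ℕ; zero; suc; _+_; _≤_; s≤s)
open import Data.Nat.Properties using (+-comm; n≤0⇒n≡0; m+n≡0⇒m≡0; m+n≡0⇒n≡0; m+n≤o⇒m≤o; m+n≤o⇒n≤o)
open import Data.Fin using (Fin; zero; suc; _≟_)
open import Data.Vec using (Vec; []; _∷_)
open import Data.Vec.Relation.Unary.All using (All; []; _∷_)
open import Data.Product using (Σ-syntax; _×_; _,_; proj₁)
open import Data.Sum using (_⊎_; inj₁; inj₂)
open import Data.Empty using (⊥-elim)
open import Function using (_∘_; id)
open import Relation.Nullary using (¬_; yes; no)
open import Relation.Binary.PropositionalEquality
  using (_≡_; _≢_; refl; sym; trans; cong; cong₂; subst; subst₂)
open import Relation.Binary.Construct.Closure.Reflexive using (ReflClosure; refl)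
import Relation.Binary.Construct.Closure.Reflexive as Refl
open import Relation.Binary.Construct.Closure.ReflexiveTransitive
  using (ε; _◅_; _◅◅_; gmap; return; reverse)

m+n≤1⇒m≡0⊎n≡0 : ∀ m {n} → m + n ≤ 1 → m ≡ 0 ⊎ n ≡ 0
m+n≤1⇒m≡0⊎n≡0 zero    _           = inj₁ refl
m+n≤1⇒m≡0⊎n≡0 (suc m) (s≤s m+n≤0) = inj₂ (n≤0⇒n≡0 (m+n≤o⇒n≤o m m+n≤0))

m+n≤1∧m≡1⇒n≡0 : ∀ {m n} → m + n ≤ 1 → m ≡ 1 → n ≡ 0
m+n≤1∧m≡1⇒n≡0 (s≤s n≤0) refl = n≤0⇒n≡0 n≤0

m+n≤1∧n≡1⇒m≡0 : ∀ {m n} → m + n ≤ 1 → n ≡ 1 → m ≡ 0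
m+n≤1∧n≡1⇒m≡0 {m} {n} m+n≤1 = m+n≤1∧m≡1⇒n≡0 (subst (_≤ 1) (+-comm m n) m+n≤1)

module FirstOrderTerms (F : Set) (α : F → ℕ) where
  open Terms F α

  data FirstOrder {n : ℕ} : Term n → Set
  data Rigid {n : ℕ} : Term n → Set

  data FirstOrder {n} where
    var   : (x : Fin n) → FirstOrder (var x)
    rigid : ∀ {t} → Rigid t → FirstOrder t

  data Rigid {n} where
    fun : (f : F) → Rigid (fun f)
    app : ∀ {t u} → Rigid t → FirstOrder u → Rigid (app t u)

  Alg⇒FirstOrder : ∀ {n} {t : Term n} → Alg t → FirstOrder t
  apps-Rigid : ∀ {n k} {h : Term n} {ts : Vec (Term n) k} → Rigid h → All Alg ts → Rigid (apps h ts)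

  Alg⇒FirstOrder (var x)      = var x
  Alg⇒FirstOrder (fn f ts as) = rigid (apps-Rigid (fun f) as)

  apps-Rigid h []       = h
  apps-Rigid h (a ∷ as) = apps-Rigid (app h (Alg⇒FirstOrder a)) as

  Alg⇒Rigid : ∀ {n} {t : Term n} → Alg t → ¬ IsVar t → Rigid t
  Alg⇒Rigid (var x)      ¬var = ⊥-elim (¬var (x , refl))
  Alg⇒Rigid (fn f ts as) _    = apps-Rigid (fun f) as

  sub-Rigid-≢-lam : ∀ {m n} {t : Term m} {U : Term n} {v} → Rigid t → (σ : Fin m → Term n) → sub σ t ≢ lam U v
  sub-Rigid-≢-lam (fun f)   σ ()
  sub-Rigid-≢-lam (app _ _) σ ()

  sub-natural : ∀ {m n k} (h : Term n → Term k) →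
    (∀ f → h (fun f) ≡ fun f) → (∀ t u → h (app t u) ≡ app (h t) (h u)) →
    ∀ {l : Term m} → FirstOrder l → (σ : Fin m → Term n) → h (sub σ l) ≡ sub (h ∘ σ) l
  sub-natural h h-fun h-app (var x)             σ = refl
  sub-natural h h-fun h-app (rigid (fun f))     σ = h-fun f
  sub-natural h h-fun h-app (rigid (app t̂ û)) σ =
    trans (h-app _ _) (cong₂ app (sub-natural h h-fun h-app (rigid t̂) σ) (sub-natural h h-fun h-app û σ))

  LinearTerm : ∀ {n} → Term n → Set
  LinearTerm t = ∀ x → occ x t ≤ 1

  _[_≔_] : ∀ {m n} → (Fin m → Term n) → Fin m → Term n → Fin m → Term n
  (σ [ y ≔ s ]) z with y ≟ z
  ... | yes _ = s
  ... | no  _ = σ z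

  update-same : ∀ {m n} (σ : Fin m → Term n) y s → (σ [ y ≔ s ]) y ≡ s
  update-same σ y s with y ≟ y
  ... | yes _  = refl
  ... | no y≢y = ⊥-elim (y≢y refl)

  occ-var-same : ∀ {m} (x : Fin m) → occ x (var x) ≡ 1
  occ-var-same x with x ≟ x
  ... | yes _  = refl
  ... | no x≢x = ⊥-elim (x≢x refl)

  sub-update-fresh : ∀ {m n} {u : Term m} → FirstOrder u → (σ : Fin m → Term n) → ∀ y s →
    occ y u ≡ 0 → sub (σ [ y ≔ s ]) u ≡ sub σ u
  sub-update-fresh (var z) σ y s y∉z with y ≟ z
  ... | no _ = refl
  sub-update-fresh (var z) σ y s () | yes _
  sub-update-fresh (rigid (fun f)) σ y s _ = refl
  sub-update-fresh (rigid (app {t} t̂ û)) σ y s y∉tu =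
    cong₂ app (sub-update-fresh (rigid t̂) σ y s (m+n≡0⇒m≡0 (occ y t) y∉tu))
              (sub-update-fresh û σ y s (m+n≡0⇒n≡0 (occ y t) y∉tu))

  _⟶β?_ : ∀ {n} → Term n → Term n → Set
  _⟶β?_ = ReflClosure _⟶β_

  sub-⟶β-inv : ∀ {m n} {r : Term m} → FirstOrder r → LinearTerm r → (σ : Fin m → Term n) → ∀ {a} →
    sub σ r ⟶β a → Σ[ y ∈ Fin m ] Σ[ s ∈ Term n ] (σ y ⟶β s × occ y r ≡ 1 × a ≡ sub (σ [ y ≔ s ]) r)
  sub-⟶β-inv (var x) _ σ {a} σx⟶a = x , a , σx⟶a , occ-var-same x , sym (update-same σ x a)
  sub-⟶β-inv (rigid (fun f))           _ σ (top ())
  sub-⟶β-inv (rigid (app (fun f) _))   _ σ (top ())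
  sub-⟶β-inv (rigid (app (app _ _) _)) _ σ (top ())
  sub-⟶β-inv (rigid (app {t} {u} t̂ û)) lin σ (appL σt⟶)
    with sub-⟶β-inv (rigid t̂) (λ x → m+n≤o⇒m≤o (occ x t) (lin x)) σ σt⟶
  ... | y , s , σy⟶s , y∈t , refl =
    y , s , σy⟶s , cong₂ _+_ y∈t y∉u , cong (app _) (sym (sub-update-fresh û σ y s y∉u))
    where
    y∉u : occ y u ≡ 0
    y∉u = m+n≤1∧m≡1⇒n≡0 (lin y) y∈t
  sub-⟶β-inv (rigid (app {t} {u} t̂ û)) lin σ (appR σu⟶)
    with sub-⟶β-inv û (λ x → m+n≤o⇒n≤o (occ x t) (lin x)) σ σu⟶
  ... | y , s , σy⟶s , y∈u , refl =
    y , s , σy⟶s , cong₂ _+_ y∉t y∈u , cong (λ t′ → app t′ _) (sym (sub-update-fresh (rigid t̂) σ y s y∉t))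
    where
    y∉t : occ y t ≡ 0
    y∉t = m+n≤1∧n≡1⇒m≡0 (lin y) y∈u

  sub-update-⟶β? : ∀ {m n} {l : Term m} → FirstOrder l → (σ : Fin m → Term n) → ∀ y {s} →
    occ y l ≤ 1 → σ y ⟶β s → sub σ l ⟶β? sub (σ [ y ≔ s ]) l
  sub-update-⟶β? (var z) σ y _ σy⟶s with y ≟ z
  ... | yes refl = Refl.[ σy⟶s ]
  ... | no  _    = refl
  sub-update-⟶β? (rigid (fun f)) σ y _ _ = refl
  sub-update-⟶β? (rigid (app {t} {u} t̂ û)) σ y {s} y≤1 σy⟶s with m+n≤1⇒m≡0⊎n≡0 (occ y t) y≤1
  ... | inj₁ y∉t rewrite sub-update-fresh (rigid t̂) σ y s y∉t =
    Refl.map appR (sub-update-⟶β? û σ y (m+n≤o⇒n≤o (occ y t) y≤1) σy⟶s)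
  ... | inj₂ y∉u rewrite sub-update-fresh û σ y s y∉u =
    Refl.map appL (sub-update-⟶β? (rigid t̂) σ y (m+n≤o⇒m≤o (occ y t) y≤1) σy⟶s)

  module ModuloEquations (R E : RuleSet)
    (E-sym        : ∀ {m} {l r : Term m} → E m l r → E m r l)
    (E-lhs-rigid  : ∀ {m} {l r : Term m} → E m l r → Rigid l)
    (E-lhs-linear : ∀ {m} {l r : Term m} → E m l r → LinearTerm l)
    where
    open System R E

    E-rhs-rigid : ∀ {m} {l r : Term m} → E m l r → Rigid r
    E-rhs-rigid = E-lhs-rigid ∘ E-sym

    E-rhs-linear : ∀ {m} {l r : Term m} → E m l r → LinearTerm r
    E-rhs-linear = E-lhs-linear ∘ E-sym

    rule-natural : ∀ {m n k} (h : Term n → Term k) →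
      (∀ f → h (fun f) ≡ fun f) → (∀ t u → h (app t u) ≡ app (h t) (h u)) →
      ∀ {l r : Term m} → E m l r → (σ : Fin m → Term n) → h (sub σ l) ⟶[ E ] h (sub σ r)
    rule-natural h h-fun h-app e σ =
      subst₂ _⟶[ E ]_ (sym (natural (E-lhs-rigid e))) (sym (natural (E-rhs-rigid e))) (top (rule e (h ∘ σ)))
      where
      natural : ∀ {t} → Rigid t → h (sub σ t) ≡ sub (h ∘ σ) t
      natural t̂ = sub-natural h h-fun h-app (rigid t̂) σ

    ⟶E-sub : ∀ {m n} (τ : Fin m → Term n) {t t′ : Term m} → t ⟶[ E ] t′ → sub τ t ⟶[ E ] sub τ t′
    ⟶E-sub τ (top (rule e σ)) = rule-natural (sub τ) (λ _ → refl) (λ _ _ → refl) e σ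
    ⟶E-sub τ (lamL s) = lamL (⟶E-sub τ s)
    ⟶E-sub τ (lamR s) = lamR (⟶E-sub (exts τ) s)
    ⟶E-sub τ (appL s) = appL (⟶E-sub τ s)
    ⟶E-sub τ (appR s) = appR (⟶E-sub τ s)
    ⟶E-sub τ (piL s)  = piL (⟶E-sub τ s)
    ⟶E-sub τ (piR s)  = piR (⟶E-sub (exts τ) s)

    ⟶E-ren : ∀ {m n} (θ : Fin m → Fin n) {t t′ : Term m} → t ⟶[ E ] t′ → ren θ t ⟶[ E ] ren θ t′
    ⟶E-ren θ (top (rule e σ)) = rule-natural (ren θ) (λ _ → refl) (λ _ _ → refl) e σ
    ⟶E-ren θ (lamL s) = lamL (⟶E-ren θ s)
    ⟶E-ren θ (lamR s) = lamR (⟶E-ren (ext θ) s)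
    ⟶E-ren θ (appL s) = appL (⟶E-ren θ s)
    ⟶E-ren θ (appR s) = appR (⟶E-ren θ s)
    ⟶E-ren θ (piL s)  = piL (⟶E-ren θ s)
    ⟶E-ren θ (piR s)  = piR (⟶E-ren (ext θ) s)

    exts-∼ : ∀ {m n} {σ σ′ : Fin m → Term n} → (∀ x → σ x ∼ σ′ x) → ∀ x → exts σ x ∼ exts σ′ x
    exts-∼ σ∼σ′ zero    = ε
    exts-∼ σ∼σ′ (suc x) = gmap (ren suc) (⟶E-ren suc) (σ∼σ′ x)

    sub-∼ : ∀ {m n} {σ σ′ : Fin m → Term n} → (∀ x → σ x ∼ σ′ x) → (t : Term m) → sub σ t ∼ sub σ′ t
    sub-∼ σ∼σ′ (sort s) = ε
    sub-∼ σ∼σ′ (var x)  = σ∼σ′ x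
    sub-∼ σ∼σ′ (fun f)  = ε
    sub-∼ {σ = σ} {σ′} σ∼σ′ (lam A b) =
      gmap (λ A′ → lam A′ (sub (exts σ) b)) lamL (sub-∼ σ∼σ′ A) ◅◅
      gmap (lam (sub σ′ A)) lamR (sub-∼ (exts-∼ σ∼σ′) b)
    sub-∼ {σ = σ} {σ′} σ∼σ′ (app t u) =
      gmap (λ t′ → app t′ (sub σ u)) appL (sub-∼ σ∼σ′ t) ◅◅
      gmap (app (sub σ′ t)) appR (sub-∼ σ∼σ′ u)
    sub-∼ {σ = σ} {σ′} σ∼σ′ (pi A b) =
      gmap (λ A′ → pi A′ (sub (exts σ) b)) piL (sub-∼ σ∼σ′ A) ◅◅
      gmap (pi (sub σ′ A)) piR (sub-∼ (exts-∼ σ∼σ′) b)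

    ⟶E-sym : ∀ {n} {t u : Term n} → t ⟶[ E ] u → u ⟶[ E ] t
    ⟶E-sym (top (rule e σ)) = top (rule (E-sym e) σ)
    ⟶E-sym (lamL s) = lamL (⟶E-sym s)
    ⟶E-sym (lamR s) = lamR (⟶E-sym s)
    ⟶E-sym (appL s) = appL (⟶E-sym s)
    ⟶E-sym (appR s) = appR (⟶E-sym s)
    ⟶E-sym (piL s)  = piL (⟶E-sym s)
    ⟶E-sym (piR s)  = piR (⟶E-sym s)

    ∼-sym : ∀ {n} {t u : Term n} → t ∼ u → u ∼ t
    ∼-sym = reverse ⟶E-sym

    _⟶β?∼_ : ∀ {n} → Term n → Term n → Set
    _⟶β?∼_ {n} t a = Σ[ b ∈ Term n ] (t ⟶β? b × b ∼ a)

    ⟶β?∼-cong : ∀ {m n} (f : Term m → Term n) →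
      (∀ {a b} → a ⟶β b → f a ⟶β f b) → (∀ {a b} → a ⟶[ E ] b → f a ⟶[ E ] f b) →
      ∀ {t a} → t ⟶β?∼ a → f t ⟶β?∼ f a
    ⟶β?∼-cong f f-β f-E (b , t⟶b , b∼a) = f b , Refl.map f-β t⟶b , gmap f f-E b∼a

    -- By linearity the β-step happens inside the instance of a single variable,
    -- which occurs at most once in l, so it can be done before the E-step.
    commute-at-root : ∀ {m n} {l r : Term m} → E m l r → (σ : Fin m → Term n) → ∀ {a} →
      sub σ r ⟶β a → sub σ l ⟶β?∼ a
    commute-at-root {l = l} e σ σr⟶a
      with sub-⟶β-inv (rigid (E-rhs-rigid e)) (E-rhs-linear e) σ σr⟶a
    ... | y , s , σy⟶s , _ , refl =
      sub (σ [ y ≔ s ]) l ,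
      sub-update-⟶β? (rigid (E-lhs-rigid e)) σ y (E-lhs-linear e y) σy⟶s ,
      return (top (rule e (σ [ y ≔ s ])))

    commute-in-operator : ∀ {n} {T T′ U : Term n} {v u} →
      T ⟶[ E ] T′ → T′ ≡ lam U v → app T u ⟶β?∼ (v [ u ])
    commute-in-operator (top (rule e σ)) eq = ⊥-elim (sub-Rigid-≢-lam (E-rhs-rigid e) σ eq)
    commute-in-operator (lamL _) refl = _ , Refl.[ top (beta _ _ _) ] , ε
    commute-in-operator {u = u} (lamR v⟶v′) refl =
      _ , Refl.[ top (beta _ _ _) ] , return (⟶E-sub (single u) v⟶v′)
    commute-in-operator (appL _) ()
    commute-in-operator (appR _) ()
    commute-in-operator (piL _)  ()
    commute-in-operator (piR _)  ()

    commute-in-argument : ∀ {n} {U : Term n} {v u u′} → u ⟶[ E ] u′ → app (lam U v) u ⟶β?∼ (v [ u′ ])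
    commute-in-argument {U = U} {v} {u} {u′} u⟶u′ = v [ u ] , Refl.[ top (beta U v u) ] , sub-∼ single-∼ v
      where
      single-∼ : ∀ x → single u x ∼ single u′ x
      single-∼ zero    = return u⟶u′
      single-∼ (suc x) = ε

    ⟶E-⟶β-commute : ∀ {n} {t t′ a : Term n} → t ⟶[ E ] t′ → t′ ⟶β a → t ⟶β?∼ a
    ⟶E-⟶β-commute (top (rule e σ)) s = commute-at-root e σ s
    ⟶E-⟶β-commute (appL e) (top (beta _ _ _)) = commute-in-operator e refl
    ⟶E-⟶β-commute (appR e) (top (beta _ _ _)) = commute-in-argument e
    ⟶E-⟶β-commute (lamL e) (top ())
    ⟶E-⟶β-commute (lamR e) (top ())
    ⟶E-⟶β-commute (piL e)  (top ())
    ⟶E-⟶β-commute (piR e)  (top ())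
    ⟶E-⟶β-commute (lamL {b = b} e) (lamL s) = ⟶β?∼-cong (λ A → lam A b) lamL lamL (⟶E-⟶β-commute e s)
    ⟶E-⟶β-commute (lamR {A = A} e) (lamR s) = ⟶β?∼-cong (lam A) lamR lamR (⟶E-⟶β-commute e s)
    ⟶E-⟶β-commute (appL {u = u} e) (appL s) = ⟶β?∼-cong (λ t → app t u) appL appL (⟶E-⟶β-commute e s)
    ⟶E-⟶β-commute (appR {t = t} e) (appR s) = ⟶β?∼-cong (app t) appR appR (⟶E-⟶β-commute e s)
    ⟶E-⟶β-commute (piL {b = b} e)  (piL s)  = ⟶β?∼-cong (λ A → pi A b) piL piL (⟶E-⟶β-commute e s)
    ⟶E-⟶β-commute (piR {A = A} e)  (piR s)  = ⟶β?∼-cong (pi A) piR piR (⟶E-⟶β-commute e s)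
    ⟶E-⟶β-commute (lamL e) (lamR s) = _ , Refl.[ lamR s ] , return (lamL e)
    ⟶E-⟶β-commute (lamR e) (lamL s) = _ , Refl.[ lamL s ] , return (lamR e)
    ⟶E-⟶β-commute (appL e) (appR s) = _ , Refl.[ appR s ] , return (appL e)
    ⟶E-⟶β-commute (appR e) (appL s) = _ , Refl.[ appL s ] , return (appR e)
    ⟶E-⟶β-commute (piL e)  (piR s)  = _ , Refl.[ piR s ] , return (piL e)
    ⟶E-⟶β-commute (piR e)  (piL s)  = _ , Refl.[ piL s ] , return (piR e)

    ∼-⟶β-commute : ∀ {n} {t t′ a : Term n} → t ∼ t′ → t′ ⟶β a → t ⟶β?∼ a
    ∼-⟶β-commute ε s = _ , Refl.[ s ] , ε
    ∼-⟶β-commute (e ◅ es) s with ∼-⟶β-commute es s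
    ... | _ , refl , b∼a = _ , refl , e ◅ b∼a
    ... | _ , Refl.[ s′ ] , b∼a with ⟶E-⟶β-commute e s′
    ... | c , t⟶c , c∼b = c , t⟶c , c∼b ◅◅ b∼a

    ⟶β?⇒▷▷* : ∀ {n} {t u : Term n} → t ⟶β? u → t ▷▷* u
    ⟶β?⇒▷▷* refl       = ε
    ⟶β?⇒▷▷* Refl.[ s ] = return (β s)

    ∼-▷▷*-commute : ∀ {n} {t t′ u : Term n} → t ∼ t′ → t′ ▷▷* u → Σ[ v ∈ Term n ] (t ▷▷* v × v ∼ u)
    ∼-▷▷*-commute t∼t′ ε = _ , ε , t∼t′
    ∼-▷▷*-commute t∼t′ (mod t′∼t″ s ◅ ss) with ∼-▷▷*-commute ε ss
    ... | v , p , v∼u = v , mod (t∼t′ ◅◅ t′∼t″) s ◅ p , v∼u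
    ∼-▷▷*-commute t∼t′ (β s ◅ ss) with ∼-⟶β-commute t∼t′ s
    ... | b , t⟶b , b∼a with ∼-▷▷*-commute b∼a ss
    ... | v , p , v∼u = v , ⟶β?⇒▷▷* t⟶b ◅◅ p , v∼u

    ⟶*⇒▷▷*∼ : ∀ {n} {t u : Term n} → t ⟶* u → Σ[ v ∈ Term n ] (t ▷▷* v × v ∼ u)
    ⟶*⇒▷▷*∼ ε = _ , ε , ε
    ⟶*⇒▷▷*∼ (s ◅ ss) with ⟶*⇒▷▷*∼ ss
    ⟶*⇒▷▷*∼ (β s ◅ _) | v , p , v∼u = v , β s ◅ p , v∼u
    ⟶*⇒▷▷*∼ (ρ s ◅ _) | v , p , v∼u = v , mod ε s ◅ p , v∼u
    ⟶*⇒▷▷*∼ (ε s ◅ _) | v , p , v∼u with ∼-▷▷*-commute (return s) p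
    ... | v′ , p′ , v′∼v = v′ , p′ , v′∼v ◅◅ v∼u

    ∼⇒⟶* : ∀ {n} {t u : Term n} → t ∼ u → t ⟶* u
    ∼⇒⟶* = gmap id _⟶_.ε

    ▷▷*⇒⟶* : ∀ {n} {t u : Term n} → t ▷▷* u → t ⟶* u
    ▷▷*⇒⟶* ε                 = ε
    ▷▷*⇒⟶* (β s ◅ ss)        = β s ◅ ▷▷*⇒⟶* ss
    ▷▷*⇒⟶* (mod t∼t′ s ◅ ss) = ∼⇒⟶* t∼t′ ◅◅ ρ s ◅ ▷▷*⇒⟶* ss

    join-⟶*⇒join-▷▷*∼ : ∀ {n} {t u : Term n} → Σ[ w ∈ Term n ] (t ⟶* w × u ⟶* w) →
      Σ[ a ∈ Term n ] Σ[ b ∈ Term n ] (t ▷▷* a × a ∼ b × u ▷▷* b)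
    join-⟶*⇒join-▷▷*∼ (w , t⟶*w , u⟶*w) with ⟶*⇒▷▷*∼ t⟶*w | ⟶*⇒▷▷*∼ u⟶*w
    ... | a , t▷▷*a , a∼w | b , u▷▷*b , b∼w = a , b , t▷▷*a , a∼w ◅◅ ∼-sym b∼w , u▷▷*b

    join-▷▷*∼⇒join-⟶* : ∀ {n} {t u : Term n} → Σ[ a ∈ Term n ] Σ[ b ∈ Term n ] (t ▷▷* a × a ∼ b × u ▷▷* b) →
      Σ[ w ∈ Term n ] (t ⟶* w × u ⟶* w)
    join-▷▷*∼⇒join-⟶* (a , b , t▷▷*a , a∼b , u▷▷*b) = b , ▷▷*⇒⟶* t▷▷*a ◅◅ ∼⇒⟶* a∼b , ▷▷*⇒⟶* u▷▷*b

lemma4 : (F : Set) (α : F → ℕ) →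
    let open Terms F α in
    (R E : RuleSet) →
    IsRewriteRules R → IsEquations E → Linear E →
    let open System R E in
    (∀ {n} (t u : Term n) → t ⟶* u → Σ[ v ∈ Term n ] (t ▷▷* v × v ∼ u)) ×
    (∀ {n} (t u : Term n) →
      ((Σ[ w ∈ Term n ] (t ⟶* w × u ⟶* w)) →
        Σ[ a ∈ Term n ] Σ[ b ∈ Term n ] (t ▷▷* a × a ∼ b × u ▷▷* b)) ×
      ((Σ[ a ∈ Term n ] Σ[ b ∈ Term n ] (t ▷▷* a × a ∼ b × u ▷▷* b)) →
        Σ[ w ∈ Term n ] (t ⟶* w × u ⟶* w)))
lemma4 F α R E _ (E-rules , E-sym , _) E-linear =
  (λ _ _ → ⟶*⇒▷▷*∼) , λ _ _ → join-⟶*⇒join-▷▷*∼ , join-▷▷*∼⇒join-⟶*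
  where
  open Terms F α
  open FirstOrderTerms F α

  lhs-rigid : ∀ {m} {l r : Term m} → E m l r → Rigid l
  lhs-rigid {m} {l} {r} e with E-rules m l r e
  ... | l-alg , l-not-var , _ = Alg⇒Rigid l-alg l-not-var

  lhs-linear : ∀ {m} {l r : Term m} → E m l r → LinearTerm l
  lhs-linear {m} {l} {r} e = proj₁ (E-linear m l r e)

  open ModuloEquations R E (E-sym _ _ _) lhs-rigid lhs-linear
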